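{- Let $G=(X\cup Y,E)$ be the complement of a bipartite chain graph. Then $\Gamma(G)=Tr(G)$.
   Context: All graphs are finite and simple. For disjoint $A,B\subseteq V$, $A$ dominates $B$ if every vertex of $B$ is adjacent to at least one vertex of $A$. A transitive $k$-partition of $G=(V,E)$ is a partition $\{V_1,\dots,V_k\}$ of $V$ into $k$ nonempty parts such that $V_i$ dominates $V_j$ for all $1\le i<j\le k$; the transitivity $Tr(G)$ is the maximum such $k$. A Grundy partition is a transitive partition in which every part is an independent set; the Grundy number $\Gamma(G)$ is the maximum order of a Grundy partition. A bipartite graph $H=(X\cup Y,E)$ is a bipartite chain graph if there are orderings $x_1,\dots,x_{n_1}$ of $X$ and $y_1,\dots,y_{n_2}$ of $Y$ with $N(x_{n_1})\subseteq\cdots\subseteq N(x_1)$ and $N(y_{n_2})\subseteq\cdots\subseteq N(y_1)$. "$G$ is the complement of a bipartite chain graph" means $\overline{G}$ is a bipartite chain graph with bipartition $X,Y$. -}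

module Defs where

open import Data.Nat using (ℕ; _≤_)
open import Data.Fin using (Fin; _<_) renaming (_≤_ to _≤ᶠ_)
open import Data.Fin.Permutation using (Permutation′; _⟨$⟩ʳ_)
open import Data.Sum using (_⊎_; inj₁; inj₂)
open import Data.Product using (Σ; ∃; ∃-syntax; _×_; _,_)
open import Data.Bool using (Bool; true; false)
open import Relation.Binary.PropositionalEquality using (_≡_; _≢_)
open import Relation.Nullary using (¬_)

record Graph (V : Set) : Set where
  field
    adj    : V → V → Bool
    sym    : ∀ u v → adj u v ≡ adj v u
    irrefl : ∀ v → adj v v ≡ false
open Graph public

Adj : {V : Set} → Graph V → V → V → Set
Adj G u v = adj G u v ≡ true

CoAdj : {V : Set} → Graph V → V → V → Set
CoAdj G u v = (u ≢ v) × (adj G u v ≡ false)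

-- A partition of V into k nonempty parts V_0,…,V_{k-1}, given by the
-- part-assignment map p (part i = p ⁻¹ i); nonemptiness = surjectivity.
Surj : {V : Set} {k : ℕ} → (V → Fin k) → Set
Surj {V} {k} p = ∀ (i : Fin k) → ∃[ v ] p v ≡ i

IsTransitivePartition : {V : Set} → Graph V → (k : ℕ) → (V → Fin k) → Set
IsTransitivePartition G k p =
  Surj p ×
  (∀ (i j : Fin k) → i < j → ∀ v → p v ≡ j → ∃[ u ] (p u ≡ i × Adj G u v))

IsGrundyPartition : {V : Set} → Graph V → (k : ℕ) → (V → Fin k) → Set
IsGrundyPartition G k p =
  IsTransitivePartition G k p × (∀ u v → p u ≡ p v → adj G u v ≡ false)

IsTransitivity : {V : Set} → Graph V → ℕ → Set
IsTransitivity G k =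
  (∃[ p ] IsTransitivePartition G k p) ×
  (∀ m (p : _ → Fin m) → IsTransitivePartition G m p → m ≤ k)

IsGrundyNumber : {V : Set} → Graph V → ℕ → Set
IsGrundyNumber G k =
  (∃[ p ] IsGrundyPartition G k p) ×
  (∀ m (p : _ → Fin m) → IsGrundyPartition G m p → m ≤ k)

IsBipartiteChain : {n₁ n₂ : ℕ} → (Fin n₁ ⊎ Fin n₂ → Fin n₁ ⊎ Fin n₂ → Set) → Set
IsBipartiteChain {n₁} {n₂} R =
  (∀ a b → ¬ R (inj₁ a) (inj₁ b)) ×
  (∀ a b → ¬ R (inj₂ a) (inj₂ b)) ×
  (Σ (Permutation′ n₁) λ σ → Σ (Permutation′ n₂) λ τ →
     (∀ (i j : Fin n₁) → i ≤ᶠ j → ∀ w → R (inj₁ (σ ⟨$⟩ʳ j)) w → R (inj₁ (σ ⟨$⟩ʳ i)) w) ×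
     (∀ (i j : Fin n₂) → i ≤ᶠ j → ∀ w → R (inj₂ (τ ⟨$⟩ʳ j)) w → R (inj₂ (τ ⟨$⟩ʳ i)) w))

{-# OPTIONS --safe #-}
-- In G the sides X and Y are cliques and the nonedges between them are nested.
-- Let a be the length of the initial run of nonadjacent diagonal pairs x_l y_l.
-- By the nesting, x_0 … x_{a-1} and y_0 … y_{a-1} form two cliques with no edge
-- between them, while x_i y_j is an edge whenever i, j ≥ a.  The pairs
-- {x_l, y_l} (l < a) followed by singletons form a Grundy partition of order
-- n₁ + n₂ − a.  Conversely, in a transitive partition let w be a vertex of
-- highest part among these 2a vertices, say w = y_j; every part then has a
-- vertex outside {x_0 … x_{a-1}} (a dominator of w, w itself, or any vertex of a
-- higher part), so its order is at most n₁ + n₂ − a.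
module Submission where

open import Defs renaming (sym to adj-sym; irrefl to adj-irrefl)
open import Data.Bool.Base using (false)
open import Data.Bool.Properties using (¬-not) renaming (_≟_ to _≟ᵇ_)
open import Data.Fin.Base using (Fin; zero; suc; toℕ; fromℕ<; inject≤; splitAt)
  renaming (_≤_ to _≤ᶠ_; _<_ to _<ᶠ_)
open import Data.Fin.Permutation using (Permutation′; _⟨$⟩ʳ_; _⟨$⟩ˡ_; inverseˡ; inverseʳ)
open import Data.Fin.Properties
  using (toℕ-injective; toℕ-fromℕ<; toℕ<n; toℕ-inject≤; inject≤-injective; injective⇒≤; +↔⊎)
  renaming (<-cmp to <ᶠ-cmp)
open import Data.List.Base using (allFin)
open import Data.List.Extrema.Nat using (argmax; f[xs]≤f[argmax])
open import Data.List.Membership.Propositional.Properties using (∈-allFin)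
open import Data.List.Relation.Unary.All using (lookup)
open import Data.Nat.Base using (ℕ; zero; suc; _+_; _∸_; _⊔_; _≤_; _<_; s<s⁻¹)
open import Data.Nat.Properties
open import Data.Product.Base using (Σ; ∃-syntax; _×_; _,_; proj₁; proj₂)
open import Data.Sum.Base using (_⊎_; inj₁; inj₂; [_,_]′)
open import Data.Sum.Properties using (inj₁-injective; inj₂-injective)
open import Function.Base using (_∘_)
open import Function.Bundles using (Injection; _↣_)
open import Function.Definitions using (Injective)
open import Function.Properties.Inverse using (↔⇒↣; ↔-sym)
open import Relation.Binary.Definitions using (tri<; tri≈; tri>)
open import Relation.Binary.PropositionalEquality
  using (_≡_; _≢_; refl; sym; trans; cong; subst; subst₂)
open import Relation.Nullary using (¬_; yes; no; contradiction)
import Relation.Nullary.Decidable as Dec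
open import Relation.Unary using (Pred; Decidable)

∃¬-smallest : ∀ {p} {P : Pred ℕ p} → Decidable P → ∀ n → (∀ i → P i → i < n) →
              ∃[ a ] (∀ i → i < a → P i) × ¬ P a
∃¬-smallest P? n bounded with P? 0
... | no ¬P0 = 0 , (λ _ ()) , ¬P0
∃¬-smallest P? zero bounded | yes P0 = contradiction (bounded 0 P0) (λ ())
∃¬-smallest {P = P} P? (suc n) bounded | yes P0
  with ∃¬-smallest {P = P ∘ suc} (P? ∘ suc) n (λ i → s<s⁻¹ ∘ bounded (suc i))
... | a , below , ¬Pa = suc a , (λ { zero _ → P0 ; (suc i) i<a → below i (s<s⁻¹ i<a) }) , ¬Pa

m<n⊎∃[o]m≡n+o : ∀ m n → m < n ⊎ ∃[ o ] m ≡ n + o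
m<n⊎∃[o]m≡n+o m n with m <? n
... | yes m<n = inj₁ m<n
... | no m≮n = let o , n+o≡m = m≤n⇒∃[o]m+o≡n (≮⇒≥ m≮n) in inj₂ (o , sym n+o≡m)

argmaxᶠ : ∀ {b} (f : Fin (suc b) → ℕ) → ∃[ i ] (∀ j → f j ≤ f i)
argmaxᶠ f =
  argmax f zero (allFin _) , λ j → lookup (f[xs]≤f[argmax] {f = f} zero (allFin _)) (∈-allFin j)

representatives⇒+≤ : ∀ {V : Set} {n m a} → V ↣ Fin n → (p : V → Fin m) (e : Fin a → V) →
                     Injective _≡_ _≡_ e → (∀ t → ∃[ u ] p u ≡ t × (∀ i → u ≢ e i)) →
                     m + a ≤ n
representatives⇒+≤ {V} {m = m} {a} ι p e e-inj rep =
  injective⇒≤ {f = Injection.to ι ∘ f ∘ splitAt m}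
    (Injection.injective (↔⇒↣ +↔⊎) ∘ f-inj _ _ ∘ Injection.injective ι)
  where
  f : Fin m ⊎ Fin a → V
  f = [ proj₁ ∘ rep , e ]′
  f-inj : ∀ s t → f s ≡ f t → s ≡ t
  f-inj (inj₁ s) (inj₁ t) eq = cong inj₁ (trans (sym (proj₁ (proj₂ (rep s))))
                                           (trans (cong p eq) (proj₁ (proj₂ (rep t)))))
  f-inj (inj₁ s) (inj₂ i) eq = contradiction eq (proj₂ (proj₂ (rep s)) i)
  f-inj (inj₂ i) (inj₁ t) eq = contradiction (sym eq) (proj₂ (proj₂ (rep t)) i)
  f-inj (inj₂ i) (inj₂ j) eq = cong inj₂ (e-inj eq)

module _ {V : Set} (G : Graph V) where

  module _ {m} {p : V → Fin m} (transitive : IsTransitivePartition G m p) where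

    private
      surjective : Surj p
      surjective = proj₁ transitive
      dominating : ∀ s t → s <ᶠ t → ∀ v → p v ≡ t → ∃[ u ] p u ≡ s × Adj G u v
      dominating = proj₂ transitive

    -- Below p w take a dominator of w, at p w take w itself, above p w any vertex.
    representatives-avoiding : ∀ {a} (e : Fin a → V) (w : V) → (∀ i → e i ≢ w) →
                               (∀ i → adj G (e i) w ≡ false) → (∀ i → p (e i) ≤ᶠ p w) →
                               ∀ t → ∃[ u ] p u ≡ t × (∀ i → u ≢ e i)
    representatives-avoiding e w e≢w e-w e≤w t with <ᶠ-cmp t (p w)
    ... | tri< t<w _ _ =
      let u , pu≡t , u-w = dominating t (p w) t<w w refl
      in u , pu≡t , λ i u≡e → contradiction
           (trans (sym u-w) (trans (cong (λ z → adj G z w) u≡e) (e-w i))) λ ()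
    ... | tri≈ _ t≡w _ = w , sym t≡w , λ i w≡e → e≢w i (sym w≡e)
    ... | tri> _ _ w<t =
      let u , pu≡t = surjective t
      in u , pu≡t , λ i u≡e → <⇒≱ w<t (subst (_≤ᶠ p w) (trans (cong p (sym u≡e)) pu≡t) (e≤w i))

    anticomplete⇒+≤ : ∀ {n a} → V ↣ Fin n → (e e′ : Fin a → V) →
                      Injective _≡_ _≡_ e → Injective _≡_ _≡_ e′ → (∀ i j → e i ≢ e′ j) →
                      (∀ i j → adj G (e i) (e′ j) ≡ false) → m + a ≤ n
    anticomplete⇒+≤ {a = zero} ι e _ _ _ _ _ =
      representatives⇒+≤ ι p e (λ { {()} }) λ t →
        let u , pu≡t = surjective t in u , pu≡t , λ ()
    anticomplete⇒+≤ {a = suc _} ι e e′ e-inj e′-inj e≢e′ e-e′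
      with argmaxᶠ (toℕ ∘ p ∘ e) | argmaxᶠ (toℕ ∘ p ∘ e′)
    ... | i* , e≤e[i*] | j* , e′≤e′[j*] with toℕ (p (e i*)) ≤? toℕ (p (e′ j*))
    ... | yes e[i*]≤e′[j*] =
      representatives⇒+≤ ι p e e-inj
        (representatives-avoiding e (e′ j*) (λ i → e≢e′ i j*) (λ i → e-e′ i j*)
          (λ i → ≤-trans (e≤e[i*] i) e[i*]≤e′[j*]))
    ... | no e[i*]≰e′[j*] =
      representatives⇒+≤ ι p e′ e′-inj
        (representatives-avoiding e′ (e i*) (λ j eq → e≢e′ i* j (sym eq))
          (λ j → trans (adj-sym G _ _) (e-e′ i* j))
          (λ j → ≤-trans (e′≤e′[j*] j) (<⇒≤ (≰⇒> e[i*]≰e′[j*]))))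

  rank⇒grundyPartition : ∀ {K} (rank : V → ℕ) → (∀ v → rank v < K) →
                         (∀ t → t < K → ∃[ v ] rank v ≡ t) →
                         (∀ v t → t < rank v → ∃[ u ] rank u ≡ t × Adj G u v) →
                         (∀ u v → rank u ≡ rank v → adj G u v ≡ false) →
                         ∃[ p ] IsGrundyPartition G K p
  rank⇒grundyPartition {K} rank rank<K onto dominated independent =
    p , (surjective , dominating) , λ u v pu≡pv → independent u v (toℕ-p-injective pu≡pv)
    where
    p : V → Fin K
    p v = fromℕ< (rank<K v)
    toℕ-p : ∀ v → toℕ (p v) ≡ rank v
    toℕ-p v = toℕ-fromℕ< (rank<K v)
    toℕ-p-injective : ∀ {u v} → p u ≡ p v → rank u ≡ rank v
    toℕ-p-injective {u} {v} eq = trans (sym (toℕ-p u)) (trans (cong toℕ eq) (toℕ-p v))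
    surjective : ∀ t → ∃[ v ] p v ≡ t
    surjective t =
      let v , rank-v = onto (toℕ t) (toℕ<n t)
      in v , toℕ-injective (trans (toℕ-p v) rank-v)
    dominating : ∀ s t → s <ᶠ t → ∀ v → p v ≡ t → ∃[ u ] p u ≡ s × Adj G u v
    dominating s t s<t v refl =
      let u , rank-u , u-v = dominated v (toℕ s) (subst (toℕ s <_) (toℕ-p v) s<t)
      in u , toℕ-injective (trans (toℕ-p u) rank-u) , u-v

  grundy⇔transitivity : ∀ {K} → ∃[ p ] IsGrundyPartition G K p →
                        (∀ m p → IsTransitivePartition G m p → m ≤ K) →
                        ∀ k → (IsGrundyNumber G k → IsTransitivity G k) ×
                              (IsTransitivity G k → IsGrundyNumber G k)
  grundy⇔transitivity {K} (q , grundy) bounded k = Γ⇒Tr , Tr⇒Γ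
    where
    Γ⇒Tr : IsGrundyNumber G k → IsTransitivity G k
    Γ⇒Tr ((p , grundy-p) , maximal) =
      (p , proj₁ grundy-p) , λ m p′ tr → ≤-trans (bounded m p′ tr) (maximal K q grundy)
    Tr⇒Γ : IsTransitivity G k → IsGrundyNumber G k
    Tr⇒Γ ((p , tr) , maximal) =
      subst (λ n → ∃[ p′ ] IsGrundyPartition G n p′) K≡k (q , grundy) ,
      λ m p′ grundy-p′ → maximal m p′ (proj₁ grundy-p′)
      where
      K≡k : K ≡ k
      K≡k = ≤-antisym (maximal K q (proj₁ grundy)) (bounded k p tr)

module ComplementOfChain {n₁ n₂ : ℕ} (G : Graph (Fin n₁ ⊎ Fin n₂))
  (X-clique : ∀ a b → ¬ CoAdj G (inj₁ a) (inj₁ b))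
  (Y-clique : ∀ a b → ¬ CoAdj G (inj₂ a) (inj₂ b))
  (σ : Permutation′ n₁) (τ : Permutation′ n₂)
  (X-nested : ∀ (i j : Fin n₁) → i ≤ᶠ j → ∀ w →
              CoAdj G (inj₁ (σ ⟨$⟩ʳ j)) w → CoAdj G (inj₁ (σ ⟨$⟩ʳ i)) w)
  (Y-nested : ∀ (i j : Fin n₂) → i ≤ᶠ j → ∀ w →
              CoAdj G (inj₂ (τ ⟨$⟩ʳ j)) w → CoAdj G (inj₂ (τ ⟨$⟩ʳ i)) w)
  where

  V : Set
  V = Fin n₁ ⊎ Fin n₂

  x : Fin n₁ → V
  x i = inj₁ (σ ⟨$⟩ʳ i)

  y : Fin n₂ → V
  y j = inj₂ (τ ⟨$⟩ʳ j)

  x-injective : Injective _≡_ _≡_ x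
  x-injective = Injection.injective (↔⇒↣ σ) ∘ inj₁-injective

  y-injective : Injective _≡_ _≡_ y
  y-injective = Injection.injective (↔⇒↣ τ) ∘ inj₂-injective

  data Side : V → Set where
    on-x : ∀ i → Side (x i)
    on-y : ∀ j → Side (y j)

  side : ∀ v → Side v
  side (inj₁ u) = subst Side (cong inj₁ (inverseʳ σ)) (on-x (σ ⟨$⟩ˡ u))
  side (inj₂ u) = subst Side (cong inj₂ (inverseʳ τ)) (on-y (τ ⟨$⟩ˡ u))

  x-adjacent : ∀ {i i′} → toℕ i < toℕ i′ → Adj G (x i) (x i′)
  x-adjacent i<i′ = ¬-not λ nonadj →
    X-clique _ _ ((λ eq → <⇒≢ i<i′ (cong toℕ (x-injective eq))) , nonadj)

  y-adjacent : ∀ {j j′} → toℕ j < toℕ j′ → Adj G (y j) (y j′)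
  y-adjacent j<j′ = ¬-not λ nonadj →
    Y-clique _ _ ((λ eq → <⇒≢ j<j′ (cong toℕ (y-injective eq))) , nonadj)

  nonadjacent-downward : ∀ {i i′ j j′} → i ≤ᶠ i′ → j ≤ᶠ j′ →
                         adj G (x i′) (y j′) ≡ false → adj G (x i) (y j) ≡ false
  nonadjacent-downward {i} {i′} {j} {j′} i≤i′ j≤j′ nonadj =
    trans (adj-sym G _ _) (proj₂ (Y-nested j j′ j≤j′ (x i) (co-sym x[i]-y[j′])))
    where
    x[i]-y[j′] : CoAdj G (x i) (y j′)
    x[i]-y[j′] = X-nested i i′ i≤i′ (y j′) ((λ ()) , nonadj)
    co-sym : CoAdj G (x i) (y j′) → CoAdj G (y j′) (x i)
    co-sym (_ , nonadj′) = (λ ()) , trans (adj-sym G _ _) nonadj′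

  DiagonalNonadjacent : ℕ → Set
  DiagonalNonadjacent l =
    Σ (l < n₁) λ l<n₁ → Σ (l < n₂) λ l<n₂ → adj G (x (fromℕ< l<n₁)) (y (fromℕ< l<n₂)) ≡ false

  diagonalNonadjacent? : Decidable DiagonalNonadjacent
  diagonalNonadjacent? l with l <? n₁ | l <? n₂
  ... | yes l<n₁ | yes l<n₂ =
    Dec.map′ (λ nonadj → l<n₁ , l<n₂ , nonadj) (proj₂ ∘ proj₂) (adj G _ _ ≟ᵇ false)
  ... | no l≮n₁ | _ = no (l≮n₁ ∘ proj₁)
  ... | yes _ | no l≮n₂ = no (l≮n₂ ∘ proj₁ ∘ proj₂)

  threshold : ∃[ a ] (∀ l → l < a → DiagonalNonadjacent l) × ¬ DiagonalNonadjacent a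
  threshold = ∃¬-smallest diagonalNonadjacent? n₁ (λ _ → proj₁)

  a : ℕ
  a = proj₁ threshold

  diagonal-below-a : ∀ l → l < a → DiagonalNonadjacent l
  diagonal-below-a = proj₁ (proj₂ threshold)

  ¬diagonal-at-a : ¬ DiagonalNonadjacent a
  ¬diagonal-at-a = proj₂ (proj₂ threshold)

  a≤n₁ : a ≤ n₁
  a≤n₁ = ≮⇒≥ λ n₁<a → n≮n n₁ (proj₁ (diagonal-below-a n₁ n₁<a))

  a≤n₂ : a ≤ n₂
  a≤n₂ = ≮⇒≥ λ n₂<a → n≮n n₂ (proj₁ (proj₂ (diagonal-below-a n₂ n₂<a)))

  nonadjacent-below-a : ∀ i j → toℕ i < a → toℕ j < a → adj G (x i) (y j) ≡ false
  nonadjacent-below-a i j i<a j<a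
    with l<n₁ , l<n₂ , nonadj ← diagonal-below-a (toℕ i ⊔ toℕ j) (⊔-lub i<a j<a) =
    nonadjacent-downward (subst (toℕ i ≤_) (sym (toℕ-fromℕ< l<n₁)) (m≤m⊔n _ _))
                         (subst (toℕ j ≤_) (sym (toℕ-fromℕ< l<n₂)) (m≤n⊔m _ _)) nonadj

  adjacent-from-a : ∀ i j → a ≤ toℕ i → a ≤ toℕ j → Adj G (x i) (y j)
  adjacent-from-a i j a≤i a≤j = ¬-not λ nonadj → ¬diagonal-at-a
    (a<n₁ , a<n₂ , nonadjacent-downward (subst (_≤ toℕ i) (sym (toℕ-fromℕ< a<n₁)) a≤i)
                                        (subst (_≤ toℕ j) (sym (toℕ-fromℕ< a<n₂)) a≤j) nonadj)
    where
    a<n₁ : a < n₁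
    a<n₁ = ≤-<-trans a≤i (toℕ<n i)
    a<n₂ : a < n₂
    a<n₂ = ≤-<-trans a≤j (toℕ<n j)

  K : ℕ
  K = n₁ + (n₂ ∸ a)

  transitive-bound : ∀ m (p : V → Fin m) → IsTransitivePartition G m p → m ≤ K
  transitive-bound m p transitive =
    subst (m ≤_) (+-∸-assoc n₁ a≤n₂) (m+n≤o⇒m≤o∸n m
      (anticomplete⇒+≤ G transitive (↔⇒↣ (↔-sym +↔⊎)) xs ys
        (λ eq → inject≤-injective a≤n₁ a≤n₁ _ _ (x-injective eq))
        (λ eq → inject≤-injective a≤n₂ a≤n₂ _ _ (y-injective eq))
        (λ _ _ ())
        (λ i j → nonadjacent-below-a _ _ (below a≤n₁ i) (below a≤n₂ j))))
    where
    xs ys : Fin a → V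
    xs i = x (inject≤ i a≤n₁)
    ys j = y (inject≤ j a≤n₂)
    below : ∀ {n} (a≤n : a ≤ n) (i : Fin a) → toℕ (inject≤ i a≤n) < a
    below a≤n i = subst (_< a) (sym (toℕ-inject≤ i a≤n)) (toℕ<n i)

  high<K : ∀ {s} → a + s < n₂ → n₁ + s < K
  high<K {s} a+s<n₂ =
    +-monoʳ-< n₁ (+-cancelˡ-< a s _ (subst (a + s <_) (sym (m+[n∸m]≡n a≤n₂)) a+s<n₂))

  high<n₂ : ∀ {s} → n₁ + s < K → a + s < n₂
  high<n₂ {s} n₁+s<K =
    subst (a + s <_) (m+[n∸m]≡n a≤n₂) (+-monoʳ-< a (+-cancelˡ-< n₁ s _ n₁+s<K))

  -- The Grundy partition: part l is {x_l, y_l} for l < a, {x_l} for a ≤ l < n₁,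
  -- and part n₁ + s is {y_{a+s}}.
  rankY : Fin n₂ → ℕ
  rankY j with toℕ j <? a
  ... | yes _ = toℕ j
  ... | no _ = n₁ + (toℕ j ∸ a)

  rank : V → ℕ
  rank (inj₁ u) = toℕ (σ ⟨$⟩ˡ u)
  rank (inj₂ u) = rankY (τ ⟨$⟩ˡ u)

  rank-x : ∀ i → rank (x i) ≡ toℕ i
  rank-x i = cong toℕ (inverseˡ σ)

  rank-y : ∀ j → rank (y j) ≡ rankY j
  rank-y j = cong rankY (inverseˡ τ)

  rankY-below-a : ∀ {j} → toℕ j < a → rankY j ≡ toℕ j
  rankY-below-a {j} j<a with toℕ j <? a
  ... | yes _ = refl
  ... | no j≮a = contradiction j<a j≮a

  rankY-from-a : ∀ {j s} → toℕ j ≡ a + s → rankY j ≡ n₁ + s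
  rankY-from-a {j} {s} j≡a+s with toℕ j <? a
  ... | yes j<a = contradiction (subst (_< a) j≡a+s j<a) (m+n≮m a s)
  ... | no _ = cong (n₁ +_) (trans (cong (_∸ a) j≡a+s) (m+n∸m≡n a s))

  rankY-below<from : ∀ {j j′ s} → toℕ j < a → toℕ j′ ≡ a + s → rankY j < rankY j′
  rankY-below<from {s = s} j<a j′≡a+s =
    subst₂ _<_ (sym (rankY-below-a j<a)) (sym (rankY-from-a j′≡a+s))
      (<-≤-trans j<a (≤-trans a≤n₁ (m≤m+n n₁ s)))

  rankY-injective : ∀ {j j′} → rankY j ≡ rankY j′ → j ≡ j′
  rankY-injective {j} {j′} eq with m<n⊎∃[o]m≡n+o (toℕ j) a | m<n⊎∃[o]m≡n+o (toℕ j′) a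
  ... | inj₁ j<a | inj₁ j′<a =
    toℕ-injective (trans (sym (rankY-below-a j<a)) (trans eq (rankY-below-a j′<a)))
  ... | inj₂ (s , j≡a+s) | inj₂ (s′ , j′≡a+s′) =
    toℕ-injective (trans j≡a+s (trans (cong (a +_) s≡s′) (sym j′≡a+s′)))
    where
    s≡s′ : s ≡ s′
    s≡s′ = +-cancelˡ-≡ n₁ _ _
             (trans (sym (rankY-from-a j≡a+s)) (trans eq (rankY-from-a j′≡a+s′)))
  ... | inj₁ j<a | inj₂ (_ , j′≡a+s′) = contradiction eq (<⇒≢ (rankY-below<from j<a j′≡a+s′))
  ... | inj₂ (_ , j≡a+s) | inj₁ j′<a =
    contradiction (sym eq) (<⇒≢ (rankY-below<from j′<a j≡a+s))

  rank-x-fromℕ< : ∀ {t} (t<n₁ : t < n₁) → rank (x (fromℕ< t<n₁)) ≡ t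
  rank-x-fromℕ< t<n₁ = trans (rank-x _) (toℕ-fromℕ< t<n₁)

  rank-y-fromℕ<-below-a : ∀ {t} (t<a : t < a) → rank (y (fromℕ< (<-≤-trans t<a a≤n₂))) ≡ t
  rank-y-fromℕ<-below-a t<a = trans (rank-y _)
    (trans (rankY-below-a (subst (_< a) (sym (toℕ-fromℕ< _)) t<a)) (toℕ-fromℕ< _))

  rank-y-fromℕ<-from-a : ∀ {s} (a+s<n₂ : a + s < n₂) → rank (y (fromℕ< a+s<n₂)) ≡ n₁ + s
  rank-y-fromℕ<-from-a a+s<n₂ = trans (rank-y _) (rankY-from-a (toℕ-fromℕ< a+s<n₂))

  rank<K : ∀ v → rank v < K
  rank<K v with side v
  ... | on-x i = subst (_< K) (sym (rank-x i)) (<-≤-trans (toℕ<n i) (m≤m+n n₁ _))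
  ... | on-y j with m<n⊎∃[o]m≡n+o (toℕ j) a
  ...   | inj₁ j<a = subst (_< K) (sym (trans (rank-y j) (rankY-below-a j<a)))
                       (<-≤-trans j<a (≤-trans a≤n₁ (m≤m+n n₁ _)))
  ...   | inj₂ (s , j≡a+s) = subst (_< K) (sym (trans (rank-y j) (rankY-from-a j≡a+s)))
                               (high<K (subst (_< n₂) j≡a+s (toℕ<n j)))

  rank-onto : ∀ t → t < K → ∃[ v ] rank v ≡ t
  rank-onto t t<K with t <? n₁
  ... | yes t<n₁ = x (fromℕ< t<n₁) , rank-x-fromℕ< t<n₁
  ... | no t≮n₁ with m≤n⇒∃[o]m+o≡n (≮⇒≥ t≮n₁)
  ...   | s , refl = y (fromℕ< (high<n₂ t<K)) , rank-y-fromℕ<-from-a (high<n₂ t<K)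

  dominated-by-low-y : ∀ {t} j → t < a → t < toℕ j → ∃[ u ] rank u ≡ t × Adj G u (y j)
  dominated-by-low-y {t} j t<a t<j =
    y (fromℕ< t<n₂) , rank-y-fromℕ<-below-a t<a ,
    y-adjacent (subst (_< toℕ j) (sym (toℕ-fromℕ< t<n₂)) t<j)
    where
    t<n₂ : t < n₂
    t<n₂ = <-≤-trans t<a a≤n₂

  y-dominated : ∀ j t → t < rankY j → ∃[ u ] rank u ≡ t × Adj G u (y j)
  y-dominated j t t<r with m<n⊎∃[o]m≡n+o (toℕ j) a
  ... | inj₁ j<a = dominated-by-low-y j (<-trans t<j j<a) t<j
    where
    t<j : t < toℕ j
    t<j = subst (t <_) (rankY-below-a j<a) t<r
  ... | inj₂ (s , j≡a+s) with t <? a | t <? n₁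
  ...   | yes t<a | _ = dominated-by-low-y j t<a (<-≤-trans t<a a≤j)
    where
    a≤j : a ≤ toℕ j
    a≤j = subst (a ≤_) (sym j≡a+s) (m≤m+n a s)
  ...   | no t≮a | yes t<n₁ =
    x (fromℕ< t<n₁) , rank-x-fromℕ< t<n₁ ,
    adjacent-from-a _ j (subst (a ≤_) (sym (toℕ-fromℕ< t<n₁)) (≮⇒≥ t≮a))
                        (subst (a ≤_) (sym j≡a+s) (m≤m+n a s))
  ...   | no _ | no t≮n₁ with m≤n⇒∃[o]m+o≡n (≮⇒≥ t≮n₁)
  ...     | s′ , refl =
    y (fromℕ< a+s′<n₂) , rank-y-fromℕ<-from-a a+s′<n₂ ,
    y-adjacent (subst (_< toℕ j) (sym (toℕ-fromℕ< a+s′<n₂)) a+s′<j)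
    where
    a+s′<j : a + s′ < toℕ j
    a+s′<j = subst (a + s′ <_) (sym j≡a+s)
               (+-monoʳ-< a (+-cancelˡ-< n₁ s′ s (subst (n₁ + s′ <_) (rankY-from-a j≡a+s) t<r)))
    a+s′<n₂ : a + s′ < n₂
    a+s′<n₂ = <-trans a+s′<j (toℕ<n j)

  rank-dominated : ∀ v t → t < rank v → ∃[ u ] rank u ≡ t × Adj G u v
  rank-dominated v t t<v with side v
  ... | on-x i = x (fromℕ< t<n₁) , rank-x-fromℕ< t<n₁ ,
                 x-adjacent (subst (_< toℕ i) (sym (toℕ-fromℕ< t<n₁)) t<i)
    where
    t<i : t < toℕ i
    t<i = subst (t <_) (rank-x i) t<v
    t<n₁ : t < n₁
    t<n₁ = <-trans t<i (toℕ<n i)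
  ... | on-y j = y-dominated j t (subst (t <_) (rank-y j) t<v)

  x-y-independent : ∀ i j → toℕ i ≡ rankY j → adj G (x i) (y j) ≡ false
  x-y-independent i j i≡r with m<n⊎∃[o]m≡n+o (toℕ j) a
  ... | inj₁ j<a = nonadjacent-below-a i j (subst (_< a) (sym i≡j) j<a) j<a
    where
    i≡j : toℕ i ≡ toℕ j
    i≡j = trans i≡r (rankY-below-a j<a)
  ... | inj₂ (s , j≡a+s) =
    contradiction (subst (_< n₁) (trans i≡r (rankY-from-a j≡a+s)) (toℕ<n i)) (m+n≮m n₁ s)

  rank-independent : ∀ u v → rank u ≡ rank v → adj G u v ≡ false
  rank-independent u v eq with side u | side v
  ... | on-x i | on-x i′ with toℕ-injective (trans (sym (rank-x i)) (trans eq (rank-x i′)))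
  ...   | refl = adj-irrefl G _
  rank-independent u v eq | on-y j | on-y j′
    with rankY-injective (trans (sym (rank-y j)) (trans eq (rank-y j′)))
  ...   | refl = adj-irrefl G _
  rank-independent u v eq | on-x i | on-y j =
    x-y-independent i j (trans (sym (rank-x i)) (trans eq (rank-y j)))
  rank-independent u v eq | on-y j | on-x i =
    trans (adj-sym G _ _)
      (x-y-independent i j (trans (sym (rank-x i)) (trans (sym eq) (rank-y j))))

  grundyPartition : ∃[ p ] IsGrundyPartition G K p
  grundyPartition = rank⇒grundyPartition G rank rank<K rank-onto rank-dominated rank-independent

theorem2 : {n₁ n₂ : ℕ} (G : Graph (Fin n₁ ⊎ Fin n₂)) →
    IsBipartiteChain (CoAdj G) →
    ∀ (k : ℕ) → (IsGrundyNumber G k → IsTransitivity G k) × (IsTransitivity G k → IsGrundyNumber G k)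
theorem2 G (X-clique , Y-clique , σ , τ , X-nested , Y-nested) =
  grundy⇔transitivity G grundyPartition transitive-bound
  where open ComplementOfChain G X-clique Y-clique σ τ X-nested Y-nested
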